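{- Let $F$ and $F'$ be finite trees, and let $R$ be a set of pendant edges of $F$. If the rooted graph $L(F)_R$ admits a valid decomposition $\mathcal{D}$ with at least one edge part such that the intersection graph $I(\mathcal{D})$ is isomorphic to the line graph of $F'$, then the incidence graph of $\mathcal{D}$ is isomorphic to the $6$-cycle or to the graph consisting of two vertices joined by three internally vertex-disjoint paths of length $3$.
   Context: $L(\cdot)$ denotes the line graph; $L(F)_R$ is $L(F)$ with root set $R$. A pendant edge is an edge with an endpoint of degree $1$. A valid decomposition of a rooted graph $G_R$ is a partition of $E(G)$ into parts each a triangle or a single edge (edge part), identified with vertex sets, such that every non-root vertex lies in exactly $3$ parts and every root in exactly $2$ parts. $I(\mathcal{D})$ is the graph on $\mathcal{D}$ in which two parts are adjacent iff they intersect. The incidence graph of $\mathcal{D}$ is the bipartite graph with parts $\bigcup\mathcal{D}$ and $\mathcal{D}$, $a\sim\alpha$ iff $a\in\alpha$. -}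

module Defs where

open import Data.Nat using (ℕ; zero; suc; _+_)
import Data.Nat as ℕ
open import Data.Fin using (Fin; zero; suc; toℕ; inject₁; fromℕ; _<_)
open import Data.Fin.Properties using (any?) renaming (_≟_ to _≟F_)
open import Data.Bool using (Bool; true; false; T; if_then_else_)
open import Data.Nat.ListAction using (sum)
open import Data.List using (List; []; _∷_; map; length; filter; allFin)
open import Data.List.Membership.Propositional using (_∈_)
open import Data.Product using (Σ; ∃; _×_; _,_; proj₁)
open import Data.Sum using (_⊎_; inj₁; inj₂)
open import Data.Empty using (⊥)
open import Relation.Nullary using (¬_; Dec)
open import Relation.Nullary.Decidable using (⌊_⌋; _×-dec_; _⊎-dec_)
open import Relation.Binary.PropositionalEquality using (_≡_; _≢_)
open import Function.Definitions using (Injective)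
open import Function.Bundles using (_↔_; _⇔_; Inverse)

record SimpleGraph (n : ℕ) : Set where
  field
    adj       : Fin n → Fin n → Bool
    adj-sym   : ∀ i j → adj i j ≡ adj j i
    adj-irrefl : ∀ i → adj i i ≡ false

record Graph : Set₁ where
  field
    V   : Set
    Adj : V → V → Set

open Graph public

record _≅_ (G H : Graph) : Set where
  field
    bij     : V G ↔ V H
    adj-iff : ∀ u v → Adj G u v ⇔ Adj H (Inverse.to bij u) (Inverse.to bij v)

module _ {n : ℕ} (G : SimpleGraph n) where
  open SimpleGraph G

  data Walk : Fin n → Fin n → Set where
    stop : ∀ {v} → Walk v v
    step : ∀ {u v w} → T (adj u v) → Walk v w → Walk u w

  Connected : Set
  Connected = ∀ u v → Walk u v

  record Cycle : Set where
    field
      len    : ℕ                      -- the cycle has  3 + len  vertices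
      vtx    : Fin (3 + len) → Fin n
      inj    : Injective _≡_ _≡_ vtx
      steps  : ∀ (i : Fin (2 + len)) → T (adj (vtx (inject₁ i)) (vtx (suc i)))
      closes : T (adj (vtx (fromℕ (2 + len))) (vtx zero))

  Acyclic : Set
  Acyclic = ¬ Cycle

  IsTree : Set
  IsTree = (0 ℕ.< n) × Connected × Acyclic

  degree : Fin n → ℕ
  degree i = sum (map (λ j → if adj i j then 1 else 0) (allFin n))

  -- edges of G, each listed once (src < tgt)
  record Edge : Set where
    constructor edge
    field
      src   : Fin n
      tgt   : Fin n
      ord   : src < tgt
      isAdj : T (adj src tgt)

  open Edge public

  SameEdge : Edge → Edge → Set
  SameEdge e f = (src e ≡ src f) × (tgt e ≡ tgt f)

  sameEdge? : ∀ e f → Dec (SameEdge e f)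
  sameEdge? e f = (src e ≟F src f) ×-dec (tgt e ≟F tgt f)

  ShareEnd : Edge → Edge → Set
  ShareEnd e f = (src e ≡ src f) ⊎ (src e ≡ tgt f) ⊎ (tgt e ≡ src f) ⊎ (tgt e ≡ tgt f)

  Pendant : Edge → Set
  Pendant e = (degree (src e) ≡ 1) ⊎ (degree (tgt e) ≡ 1)

  AdjL : Edge → Edge → Set
  AdjL e f = ¬ SameEdge e f × ShareEnd e f

  LineGraph : Graph
  LineGraph = record { V = Edge ; Adj = AdjL }

  -- Parts of a decomposition of L(G): a triangle or a single edge,
  -- identified with its vertex set.

  data Part : Set where
    tri : Edge → Edge → Edge → Part
    edg : Edge → Edge → Part

  IsEdgePart : Part → Set
  IsEdgePart (tri _ _ _) = ⊥
  IsEdgePart (edg _ _)   = Data.Unit.⊤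
    where import Data.Unit

  PartInL : Part → Set
  PartInL (tri a b c) = AdjL a b × AdjL b c × AdjL a c
  PartInL (edg a b)   = AdjL a b

  _∈ᴾ_ : Edge → Part → Set
  v ∈ᴾ tri a b c = SameEdge v a ⊎ SameEdge v b ⊎ SameEdge v c
  v ∈ᴾ edg a b   = SameEdge v a ⊎ SameEdge v b

  _∈ᴾ?_ : ∀ v P → Dec (v ∈ᴾ P)
  v ∈ᴾ? tri a b c = sameEdge? v a ⊎-dec (sameEdge? v b ⊎-dec sameEdge? v c)
  v ∈ᴾ? edg a b   = sameEdge? v a ⊎-dec sameEdge? v b

  module _ {m : ℕ} (D : Fin m → Part) where

    partCount : Edge → ℕ
    partCount v = length (filter (λ i → v ∈ᴾ? D i) (allFin m))

    -- valid decomposition of L(G)_R, R ⊆ V(L(G)) = E(G) given as a Boolean predicate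
    record ValidDecomposition (R : Edge → Bool) : Set where
      field
        parts-in-L : ∀ i → PartInL (D i)
        covers     : ∀ a b → AdjL a b → ∃ λ i → (a ∈ᴾ D i) × (b ∈ᴾ D i)
        disjoint   : ∀ a b → AdjL a b → ∀ i j →
                     a ∈ᴾ D i → b ∈ᴾ D i → a ∈ᴾ D j → b ∈ᴾ D j → i ≡ j
        counts     : ∀ v → partCount v ≡ (if R v then 2 else 3)

    IntersectionGraph : Graph
    IntersectionGraph = record
      { V   = Fin m
      ; Adj = λ i j → (i ≢ j) × ∃ λ v → (v ∈ᴾ D i) × (v ∈ᴾ D j) }

    covered : Edge → Bool
    covered v = ⌊ any? (λ i → v ∈ᴾ? D i) ⌋

    UnionD : Set
    UnionD = Σ Edge (λ v → T (covered v))

    IncAdj : UnionD ⊎ Fin m → UnionD ⊎ Fin m → Set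
    IncAdj (inj₁ v) (inj₂ i) = proj₁ v ∈ᴾ D i
    IncAdj (inj₂ i) (inj₁ v) = proj₁ v ∈ᴾ D i
    IncAdj (inj₁ _) (inj₁ _) = ⊥
    IncAdj (inj₂ _) (inj₂ _) = ⊥

    IncidenceGraph : Graph
    IncidenceGraph = record { V = UnionD ⊎ Fin m ; Adj = IncAdj }

fromEdges : (k : ℕ) → List (ℕ × ℕ) → Graph
fromEdges k es = record
  { V   = Fin k
  ; Adj = λ i j → ((toℕ i , toℕ j) ∈ es) ⊎ ((toℕ j , toℕ i) ∈ es) }

C6 : Graph
C6 = fromEdges 6 ((0 , 1) ∷ (1 , 2) ∷ (2 , 3) ∷ (3 , 4) ∷ (4 , 5) ∷ (5 , 0) ∷ [])

Theta333 : Graph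
Theta333 = fromEdges 8
  ( (0 , 2) ∷ (2 , 3) ∷ (3 , 1)
  ∷ (0 , 4) ∷ (4 , 5) ∷ (5 , 1)
  ∷ (0 , 6) ∷ (6 , 7) ∷ (7 , 1) ∷ [])

{-# OPTIONS --safe #-}
-- Since I(D) ≅ L(F′) is the line graph of a tree, it has no induced 4-cycle and no induced diamond.
-- If F had a path u′uww′, its middle edge, not being pendant, would lie in three parts, and the
-- diamonds this creates in I(D) would produce a triangle in F. So F is a star, L(F) is complete, and
-- any two edges of F lie in exactly one common part. Let {a, b} be the edge part; a and b each lie in
-- two or three parts. By the 4-cycle condition every other part through a meets every other part
-- through b, and this pins D down: two and two parts give the 6-cycle, two and three give the theta
-- graph, and three and three produce an induced diamond.
module Submission where

open import Defs
open import Data.Bool using (Bool; true; false; T; if_then_else_)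
open import Data.Bool.Properties using (T-irrelevant; T?; T-≡)
open import Data.Empty using (⊥; ⊥-elim)
open import Data.Fin using (Fin; toℕ; _<_)
open import Data.Fin.Patterns using (0F; 1F; 2F; 3F)
open import Data.Fin.Properties using (all?; <-asym; <-cmp; <-irrelevant) renaming (_≟_ to _≟ᶠ_)
open import Data.List using (List; []; _∷_; map; filter; allFin; length)
open import Data.List.Membership.Propositional using () renaming (_∈_ to _∈ˡ_)
open import Data.List.Membership.Propositional.Properties using (∈-filter⁺; ∈-filter⁻; ∈-allFin)
import Data.List.Membership.DecPropositional as ListMembership
open import Data.List.Relation.Unary.Any using (here; there)
open import Data.List.Relation.Unary.All using ([]; _∷_)
open import Data.List.Relation.Unary.AllPairs using ([]; _∷_)
open import Data.List.Relation.Unary.Unique.Propositional using () renaming (Unique to Uniqueˡ)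
open import Data.List.Relation.Unary.Unique.Propositional.Properties using (filter⁺; allFin⁺)
open import Data.Nat using (ℕ; _+_; _≤_)
open import Data.Nat.ListAction using (sum)
open import Data.Nat.Properties using (≤-trans; <-irrefl; m≤m+n; m≤n+m; +-monoʳ-≤; +-comm) renaming (_≟_ to _≟ⁿ_)
open import Data.Product using (∃; ∃₂; _×_; _,_; proj₁; proj₂)
import Data.Product.Properties as Product
open import Data.Sum using (_⊎_; inj₁; inj₂; [_,_]; [_,_]′; swap)
open import Data.Sum.Function.Propositional using (_⊎-↔_)
import Data.Sum.Properties as Sum
open import Data.Unit using (tt)
open import Data.Vec using (Vec; []; _∷_; lookup)
open import Data.Vec.Membership.Propositional using (_∈_)
import Data.Vec.Membership.DecPropositional as VecMembership
open import Data.Vec.Relation.Unary.Any using (index; here; there)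
open import Data.Vec.Relation.Unary.Any.Properties using (lookup-index)
open import Data.Vec.Relation.Unary.All using ([]; _∷_)
open import Data.Vec.Relation.Unary.AllPairs using (allPairs?; []; _∷_)
open import Data.Vec.Relation.Unary.Unique.Propositional using (Unique)
open import Data.Vec.Relation.Unary.Unique.Propositional.Properties using (lookup-injective)
open import Function using (_∘_; case_of_)
open import Function.Bundles using (Inverse; Injection; Equivalence; _↔_; _⇔_; mk↔ₛ′; mk⇔)
open import Function.Construct.Composition using (_↔-∘_; _⇔-∘_)
open import Function.Construct.Symmetry using (↔-sym; ⇔-sym)
open import Function.Properties.Inverse using (↔⇒↣)
open import Relation.Binary.Definitions using (DecidableEquality; tri<; tri≈; tri>)
open import Relation.Binary.PropositionalEquality hiding ([_])
open import Relation.Nullary using (¬_; Dec; yes; no; ¬?)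
open import Relation.Nullary.Decidable using (map′; _×-dec_; _⊎-dec_; _→-dec_; from-yes; fromWitness)
open import Relation.Nullary.Reflects using (Reflects; ofʸ; ofⁿ)
open import Relation.Unary using (Decidable)

≅-sym : ∀ {G H} → G ≅ H → H ≅ G
≅-sym {G} {H} G≅H = record { bij = ↔-sym bij ; adj-iff = adj-iff′ }
  where
    open _≅_ G≅H
    open Inverse bij using (from; strictlyInverseˡ)

    adj-iff′ : ∀ u v → Adj H u v ⇔ Adj G (from u) (from v)
    adj-iff′ u v = ⇔-sym (subst₂ (λ x y → Adj G (from u) (from v) ⇔ Adj H x y)
                                 (strictlyInverseˡ u) (strictlyInverseˡ v) (adj-iff (from u) (from v)))

≅-trans : ∀ {G H K} → G ≅ H → H ≅ K → G ≅ K
≅-trans G≅H H≅K = record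
  { bij     = _≅_.bij H≅K ↔-∘ _≅_.bij G≅H
  ; adj-iff = λ u v → _≅_.adj-iff H≅K _ _ ⇔-∘ _≅_.adj-iff G≅H u v
  }

enumeration : ∀ {A : Set} {k} (xs : Vec A k) → Unique xs → (∀ x → x ∈ xs) → Fin k ↔ A
enumeration xs unique complete = mk↔ₛ′ (lookup xs) (index ∘ complete)
  (λ x → sym (lookup-index (complete x)))
  (λ i → lookup-injective unique _ i (sym (lookup-index (complete (lookup xs i)))))

reflects⇒⇔ : ∀ {A : Set} {b} → Reflects A b → A ⇔ T b
reflects⇒⇔ (ofʸ a)  = mk⇔ (λ _ → tt) (λ _ → a)
reflects⇒⇔ (ofⁿ ¬a) = mk⇔ ¬a (λ ())

_⇔?_ : ∀ {A B : Set} → Dec A → Dec B → Dec (A ⇔ B)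
A? ⇔? B? = map′ (λ (f , g) → mk⇔ f g) (λ A⇔B → Equivalence.to A⇔B , Equivalence.from A⇔B)
                ((A? →-dec B?) ×-dec (B? →-dec A?))

all⊎? : ∀ {k l} {P : Fin k ⊎ Fin l → Set} → Decidable P → Dec (∀ z → P z)
all⊎? P? = map′ (λ (left , right) → [ left , right ]) (λ all → all ∘ inj₁ , all ∘ inj₂)
                (all? (P? ∘ inj₁) ×-dec all? (P? ∘ inj₂))

Matrix : ℕ → ℕ → Set
Matrix k l = Vec (Vec Bool l) k

entry : ∀ {k l} → Matrix k l → Fin k → Fin l → Bool
entry M s t = lookup (lookup M s) t

biadjacent : ∀ {k l} → Matrix k l → Fin k ⊎ Fin l → Fin k ⊎ Fin l → Bool
biadjacent M (inj₁ s) (inj₂ t) = entry M s t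
biadjacent M (inj₂ t) (inj₁ s) = entry M s t
biadjacent M (inj₁ _) (inj₁ _) = false
biadjacent M (inj₂ _) (inj₂ _) = false

Biadjacency : ∀ {k l} → Matrix k l → Graph
Biadjacency {k} {l} M = record { V = Fin k ⊎ Fin l ; Adj = λ u v → T (biadjacent M u v) }

module Layout {N k l : ℕ} (es : List (ℕ × ℕ)) (M : Matrix k l) (layout : Vec (Fin k ⊎ Fin l) N) where

  IsLayout : Set
  IsLayout = Unique layout × (∀ z → z ∈ layout)
           × (∀ u v → Adj (fromEdges N es) u v ⇔ Adj (Biadjacency M) (lookup layout u) (lookup layout v))

  isLayout? : Dec IsLayout
  isLayout? = allPairs? (λ x y → ¬? (x ≟ y)) layout
            ×-dec all⊎? (_∈? layout)
            ×-dec all? (λ u → all? (λ v → (edge? u v ⊎-dec edge? v u) ⇔? T? _))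
    where
      _≟_ = Sum.≡-dec _≟ᶠ_ _≟ᶠ_
      open VecMembership _≟_ using (_∈?_)
      open ListMembership (Product.≡-dec _≟ⁿ_ _≟ⁿ_) renaming (_∈?_ to _∈ˡ?_)
      edge? : (u v : Fin N) → Dec ((toℕ u , toℕ v) ∈ˡ es)
      edge? u v = (toℕ u , toℕ v) ∈ˡ? es

  fromEdges≅biadjacency : IsLayout → fromEdges N es ≅ Biadjacency M
  fromEdges≅biadjacency (unique , complete , adj-iff) =
    record { bij = enumeration layout unique complete ; adj-iff = adj-iff }

c6-matrix : Matrix 3 3
c6-matrix = (true  ∷ true  ∷ false ∷ [])
          ∷ (true  ∷ false ∷ true  ∷ [])
          ∷ (false ∷ true  ∷ true  ∷ [])
          ∷ []

biadjacency≅C6 : Biadjacency c6-matrix ≅ C6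
biadjacency≅C6 = ≅-sym (fromEdges≅biadjacency (from-yes isLayout?))
  where open Layout _ c6-matrix (inj₁ 0F ∷ inj₂ 0F ∷ inj₁ 1F ∷ inj₂ 2F ∷ inj₁ 2F ∷ inj₂ 1F ∷ [])

θ-matrix : Matrix 4 4
θ-matrix = (true  ∷ true  ∷ false ∷ false ∷ [])
         ∷ (true  ∷ false ∷ true  ∷ true  ∷ [])
         ∷ (false ∷ true  ∷ true  ∷ false ∷ [])
         ∷ (false ∷ true  ∷ false ∷ true  ∷ [])
         ∷ []

biadjacency≅Θ : Biadjacency θ-matrix ≅ Theta333
biadjacency≅Θ = ≅-sym (fromEdges≅biadjacency (from-yes isLayout?))
  where
    open Layout _ θ-matrix
      (inj₁ 1F ∷ inj₂ 1F ∷ inj₂ 0F ∷ inj₁ 0F ∷ inj₂ 2F ∷ inj₁ 2F ∷ inj₂ 3F ∷ inj₁ 3F ∷ [])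

module _ {n m : ℕ} {F : SimpleGraph n} {D : Fin m → Part F} where

  union↔edges : (∀ x → ∃ λ i → _∈ᴾ_ F x (D i)) → UnionD F D ↔ Edge F
  union↔edges covered = mk↔ₛ′ proj₁ (λ x → x , fromWitness (covered x)) (λ _ → refl)
                                (λ (x , c) → cong (x ,_) (T-irrelevant _ c))

  incidence≅biadjacency : ∀ {k l} (edges : Fin k ↔ Edge F) (parts : Fin l ↔ Fin m) →
                          (∀ x → ∃ λ i → _∈ᴾ_ F x (D i)) → (M : Matrix k l) →
                          (∀ s t → Reflects (_∈ᴾ_ F (Inverse.to edges s) (D (Inverse.to parts t))) (entry M s t)) →
                          IncidenceGraph F D ≅ Biadjacency M
  incidence≅biadjacency {k} {l} edges parts covered M incidence = record { bij = bij ; adj-iff = adj-iff }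
    where
      open Inverse edges using () renaming (from to edge-index; strictlyInverseˡ to edge-index-inverse)
      open Inverse parts using () renaming (from to part-index; strictlyInverseˡ to part-index-inverse)

      bij : (UnionD F D ⊎ Fin m) ↔ (Fin k ⊎ Fin l)
      bij = (↔-sym edges ↔-∘ union↔edges covered) ⊎-↔ ↔-sym parts

      member⇔entry : ∀ x i → _∈ᴾ_ F x (D i) ⇔ T (entry M (edge-index x) (part-index i))
      member⇔entry x i = subst₂ (λ y j → _∈ᴾ_ F y (D j) ⇔ T (entry M (edge-index x) (part-index i)))
                                (edge-index-inverse x) (part-index-inverse i) (reflects⇒⇔ (incidence _ _))

      adj-iff : ∀ u v → Adj (IncidenceGraph F D) u v ⇔ Adj (Biadjacency M) (Inverse.to bij u) (Inverse.to bij v)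
      adj-iff (inj₁ (x , _)) (inj₂ i) = member⇔entry x i
      adj-iff (inj₂ i) (inj₁ (x , _)) = member⇔entry x i
      adj-iff (inj₁ _) (inj₁ _) = mk⇔ (λ ()) (λ ())
      adj-iff (inj₂ _) (inj₂ _) = mk⇔ (λ ()) (λ ())

module Count {m : ℕ} {P : Fin m → Set} (P? : Decidable P) where

  private
    ∈filter⇒P : ∀ {k} → k ∈ˡ filter P? (allFin m) → P k
    ∈filter⇒P k∈ = proj₂ (∈-filter⁻ P? {xs = allFin m} k∈)

    P⇒∈filter : ∀ {k} → P k → k ∈ˡ filter P? (allFin m)
    P⇒∈filter Pk = ∈-filter⁺ P? (∈-allFin _) Pk

    filter-unique : Uniqueˡ (filter P? (allFin m))
    filter-unique = filter⁺ P? (allFin⁺ m)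

  count≡2 : ∀ {i} → length (filter P? (allFin m)) ≡ 2 → P i →
            ∃ λ j → j ≢ i × P j × (∀ k → P k → k ≡ i ⊎ k ≡ j)
  count≡2 {i} len Pi = listed _ filter-unique ∈filter⇒P P⇒∈filter len (P⇒∈filter Pi)
    where
      listed : ∀ xs → Uniqueˡ xs → (∀ {k} → k ∈ˡ xs → P k) → (∀ {k} → P k → k ∈ˡ xs) →
               length xs ≡ 2 → i ∈ˡ xs → ∃ λ j → j ≢ i × P j × (∀ k → P k → k ≡ i ⊎ k ≡ j)
      listed (j₁ ∷ j₂ ∷ []) ((j₁≢j₂ ∷ []) ∷ _) sound complete refl i∈xs with i∈xs
      ... | here refl =
        j₂ , j₁≢j₂ ∘ sym , sound (there (here refl)) , λ k Pk → case complete Pk of λ where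
          (here k≡j₁)         → inj₁ k≡j₁
          (there (here k≡j₂)) → inj₂ k≡j₂
      ... | there (here refl) =
        j₁ , j₁≢j₂ , sound (here refl) , λ k Pk → case complete Pk of λ where
          (here k≡j₁)         → inj₂ k≡j₁
          (there (here k≡j₂)) → inj₁ k≡j₂

  count≡3 : ∀ {i} → length (filter P? (allFin m)) ≡ 3 → P i →
            ∃₂ λ j j′ → j ≢ i × j′ ≢ i × j ≢ j′ × P j × P j′ × (∀ k → P k → k ≡ i ⊎ k ≡ j ⊎ k ≡ j′)
  count≡3 {i} len Pi = listed _ filter-unique ∈filter⇒P P⇒∈filter len (P⇒∈filter Pi)
    where
      listed : ∀ xs → Uniqueˡ xs → (∀ {k} → k ∈ˡ xs → P k) → (∀ {k} → P k → k ∈ˡ xs) →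
               length xs ≡ 3 → i ∈ˡ xs →
               ∃₂ λ j j′ → j ≢ i × j′ ≢ i × j ≢ j′ × P j × P j′ × (∀ k → P k → k ≡ i ⊎ k ≡ j ⊎ k ≡ j′)
      listed (j₁ ∷ j₂ ∷ j₃ ∷ []) ((j₁≢j₂ ∷ j₁≢j₃ ∷ []) ∷ (j₂≢j₃ ∷ []) ∷ _) sound complete refl i∈xs
        with i∈xs
      ... | here refl =
        j₂ , j₃ , j₁≢j₂ ∘ sym , j₁≢j₃ ∘ sym , j₂≢j₃ , sound (there (here refl)) , sound (there (there (here refl))) ,
        λ k Pk → case complete Pk of λ where
          (here k≡j₁)                 → inj₁ k≡j₁
          (there (here k≡j₂))         → inj₂ (inj₁ k≡j₂)
          (there (there (here k≡j₃))) → inj₂ (inj₂ k≡j₃)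
      ... | there (here refl) =
        j₁ , j₃ , j₁≢j₂ , j₂≢j₃ ∘ sym , j₁≢j₃ , sound (here refl) , sound (there (there (here refl))) ,
        λ k Pk → case complete Pk of λ where
          (here k≡j₁)                 → inj₂ (inj₁ k≡j₁)
          (there (here k≡j₂))         → inj₁ k≡j₂
          (there (there (here k≡j₃))) → inj₂ (inj₂ k≡j₃)
      ... | there (there (here refl)) =
        j₁ , j₂ , j₁≢j₃ , j₂≢j₃ , j₁≢j₂ , sound (here refl) , sound (there (here refl)) ,
        λ k Pk → case complete Pk of λ where
          (here k≡j₁)                 → inj₂ (inj₁ k≡j₁)
          (there (here k≡j₂))         → inj₂ (inj₂ k≡j₂)
          (there (there (here k≡j₃))) → inj₁ k≡j₃

  count≡3⇒third : ∀ {i} → length (filter P? (allFin m)) ≡ 3 → P i → ∀ j →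
                  ∃ λ k → P k × k ≢ i × k ≢ j
  count≡3⇒third len Pi j with count≡3 len Pi
  ... | k₁ , k₂ , k₁≢i , k₂≢i , k₁≢k₂ , Pk₁ , Pk₂ , _ with k₁ ≟ᶠ j
  ... | yes refl = k₂ , Pk₂ , k₂≢i , k₁≢k₂ ∘ sym
  ... | no k₁≢j  = k₁ , Pk₁ , k₁≢i , k₁≢j

member≤sum : ∀ {A : Set} (f : A → ℕ) {x} xs → x ∈ˡ xs → f x ≤ sum (map f xs)
member≤sum f (x ∷ xs) (here refl) = m≤m+n (f x) _
member≤sum f (y ∷ xs) (there x∈) = ≤-trans (member≤sum f xs x∈) (m≤n+m _ (f y))

two-members≤sum : ∀ {A : Set} (f : A → ℕ) {x y} xs → x ∈ˡ xs → y ∈ˡ xs → x ≢ y →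
                  f x + f y ≤ sum (map f xs)
two-members≤sum f (z ∷ xs) (here refl) (here refl) x≢y = ⊥-elim (x≢y refl)
two-members≤sum f (z ∷ xs) (here refl) (there y∈) _ = +-monoʳ-≤ (f z) (member≤sum f xs y∈)
two-members≤sum f (z ∷ xs) (there x∈) (here refl) _ =
  subst (_≤ f z + sum (map f xs)) (+-comm (f z) _) (+-monoʳ-≤ (f z) (member≤sum f xs x∈))
two-members≤sum f (z ∷ xs) (there x∈) (there y∈) x≢y =
  ≤-trans (two-members≤sum f xs x∈ y∈ x≢y) (m≤n+m _ (f z))

module Edges {n : ℕ} (G : SimpleGraph n) where
  open SimpleGraph G

  adj-flip : ∀ {u v} → T (adj u v) → T (adj v u)
  adj-flip {u} {v} = subst T (adj-sym u v)

  adj⇒≢ : ∀ {u v} → T (adj u v) → u ≢ v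
  adj⇒≢ {u} uu refl = subst T (adj-irrefl u) uu

  two-neighbours⇒degree≢1 : ∀ {v u₁ u₂} → T (adj v u₁) → T (adj v u₂) → u₁ ≢ u₂ → degree G v ≢ 1
  two-neighbours⇒degree≢1 {v} {u₁} {u₂} vu₁ vu₂ u₁≢u₂ deg≡1 =
    <-irrefl refl (subst₂ _≤_ (cong₂ _+_ (neighbour vu₁) (neighbour vu₂)) deg≡1
                          (two-members≤sum indicator (allFin n) (∈-allFin u₁) (∈-allFin u₂) u₁≢u₂))
    where
      indicator : Fin n → ℕ
      indicator j = if adj v j then 1 else 0
      neighbour : ∀ {u} → T (adj v u) → indicator u ≡ 1
      neighbour vu rewrite Equivalence.to T-≡ vu = refl

  SameEdge⇒≡ : ∀ {e f : Edge G} → SameEdge G e f → e ≡ f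
  SameEdge⇒≡ {edge s t s<t st} {edge .s .t s<t′ st′} (refl , refl) =
    cong₂ (edge s t) (<-irrelevant s<t s<t′) (T-irrelevant st st′)

  _≟ᴱ_ : DecidableEquality (Edge G)
  e ≟ᴱ f = map′ SameEdge⇒≡ (λ { refl → refl , refl }) (sameEdge? G e f)

  no-reversed-edges : ∀ {e f : Edge G} → src e ≡ tgt f → tgt e ≡ src f → ⊥
  no-reversed-edges {e} {f} s≡t t≡s = <-asym (ord f) (subst₂ _<_ s≡t t≡s (ord e))

  infix 4 _∋_
  data _∋_ (e : Edge G) (v : Fin n) : Set where
    src∋ : src e ≡ v → e ∋ v
    tgt∋ : tgt e ≡ v → e ∋ v

  endpoints-adjacent : ∀ {e x y} → e ∋ x → e ∋ y → x ≢ y → T (adj x y)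
  endpoints-adjacent     (src∋ refl) (src∋ refl) x≢y = ⊥-elim (x≢y refl)
  endpoints-adjacent {e} (src∋ refl) (tgt∋ refl) _   = isAdj e
  endpoints-adjacent {e} (tgt∋ refl) (src∋ refl) _   = adj-flip (isAdj e)
  endpoints-adjacent     (tgt∋ refl) (tgt∋ refl) x≢y = ⊥-elim (x≢y refl)

  endpoint-is-one-of : ∀ {e x y z} → e ∋ x → e ∋ y → x ≢ y → e ∋ z → z ≡ x ⊎ z ≡ y
  endpoint-is-one-of (src∋ refl) (src∋ refl) x≢y _           = ⊥-elim (x≢y refl)
  endpoint-is-one-of (src∋ refl) (tgt∋ refl) _   (src∋ refl) = inj₁ refl
  endpoint-is-one-of (src∋ refl) (tgt∋ refl) _   (tgt∋ refl) = inj₂ refl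
  endpoint-is-one-of (tgt∋ refl) (src∋ refl) _   (src∋ refl) = inj₂ refl
  endpoint-is-one-of (tgt∋ refl) (src∋ refl) _   (tgt∋ refl) = inj₁ refl
  endpoint-is-one-of (tgt∋ refl) (tgt∋ refl) x≢y _           = ⊥-elim (x≢y refl)

  same-endpoints⇒≡ : ∀ {e f x y} → e ∋ x → e ∋ y → x ≢ y → f ∋ x → f ∋ y → e ≡ f
  same-endpoints⇒≡ (src∋ refl) (src∋ refl) x≢y _ _ = ⊥-elim (x≢y refl)
  same-endpoints⇒≡ (tgt∋ refl) (tgt∋ refl) x≢y _ _ = ⊥-elim (x≢y refl)
  same-endpoints⇒≡ _ _ x≢y (src∋ p) (src∋ q) = ⊥-elim (x≢y (trans (sym p) q))
  same-endpoints⇒≡ _ _ x≢y (tgt∋ p) (tgt∋ q) = ⊥-elim (x≢y (trans (sym p) q))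
  same-endpoints⇒≡ (src∋ p) (tgt∋ q) _ (src∋ p′) (tgt∋ q′) = SameEdge⇒≡ (trans p (sym p′) , trans q (sym q′))
  same-endpoints⇒≡ (tgt∋ p) (src∋ q) _ (tgt∋ p′) (src∋ q′) = SameEdge⇒≡ (trans q (sym q′) , trans p (sym p′))
  same-endpoints⇒≡ {e} {f} (src∋ p) (tgt∋ q) _ (tgt∋ p′) (src∋ q′) =
    ⊥-elim (no-reversed-edges {e} {f} (trans p (sym p′)) (trans q (sym q′)))
  same-endpoints⇒≡ {e} {f} (tgt∋ p) (src∋ q) _ (src∋ p′) (tgt∋ q′) =
    ⊥-elim (no-reversed-edges {e} {f} (trans q (sym q′)) (trans p (sym p′)))

  other-endpoint : ∀ {e z} → e ∋ z → ∃ λ z′ → e ∋ z′ × z′ ≢ z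
  other-endpoint {e} (src∋ refl) = tgt e , tgt∋ refl , adj⇒≢ (isAdj e) ∘ sym
  other-endpoint {e} (tgt∋ refl) = src e , src∋ refl , adj⇒≢ (isAdj e)

  edge-between : ∀ {u v} → T (adj u v) → ∃ λ e → e ∋ u × e ∋ v
  edge-between {u} {v} uv with <-cmp u v
  ... | tri< u<v _ _ = edge u v u<v uv , src∋ refl , tgt∋ refl
  ... | tri≈ _ u≡v _ = ⊥-elim (adj⇒≢ uv u≡v)
  ... | tri> _ _ v<u = edge v u v<u (adj-flip uv) , tgt∋ refl , src∋ refl

  common-endpoint⇒share : ∀ {e f v} → e ∋ v → f ∋ v → ShareEnd G e f
  common-endpoint⇒share (src∋ refl) (src∋ q) = inj₁ (sym q)
  common-endpoint⇒share (src∋ refl) (tgt∋ q) = inj₂ (inj₁ (sym q))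
  common-endpoint⇒share (tgt∋ refl) (src∋ q) = inj₂ (inj₂ (inj₁ (sym q)))
  common-endpoint⇒share (tgt∋ refl) (tgt∋ q) = inj₂ (inj₂ (inj₂ (sym q)))

  share⇒common-endpoint : ∀ {e f : Edge G} → ShareEnd G e f → ∃ λ v → e ∋ v × f ∋ v
  share⇒common-endpoint {e} (inj₁ p)               = src e , src∋ refl , src∋ (sym p)
  share⇒common-endpoint {e} (inj₂ (inj₁ p))        = src e , src∋ refl , tgt∋ (sym p)
  share⇒common-endpoint {e} (inj₂ (inj₂ (inj₁ p))) = tgt e , tgt∋ refl , src∋ (sym p)
  share⇒common-endpoint {e} (inj₂ (inj₂ (inj₂ p))) = tgt e , tgt∋ refl , tgt∋ (sym p)

  share? : ∀ e f → Dec (ShareEnd G e f)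
  share? e f = src e ≟ᶠ src f ⊎-dec src e ≟ᶠ tgt f ⊎-dec tgt e ≟ᶠ src f ⊎-dec tgt e ≟ᶠ tgt f

  share-refl : ∀ e → ShareEnd G e e
  share-refl _ = inj₁ refl

  share-sym : ∀ {e f : Edge G} → ShareEnd G e f → ShareEnd G f e
  share-sym {e} {f} s with share⇒common-endpoint {e} {f} s
  ... | _ , e∋v , f∋v = common-endpoint⇒share f∋v e∋v

  adjL-intro : ∀ {e f : Edge G} → e ≢ f → ShareEnd G e f → AdjL G e f
  adjL-intro e≢f s = e≢f ∘ SameEdge⇒≡ , s

  adjL⇒≢ : ∀ {e f : Edge G} → AdjL G e f → e ≢ f
  adjL⇒≢ (¬same , _) refl = ¬same (refl , refl)

  inner-edge-not-pendant : ∀ {e u′ u w w′} → e ∋ u → e ∋ w →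
                           T (adj u′ u) → T (adj u w) → T (adj w w′) → u′ ≢ w → u ≢ w′ → ¬ Pendant G e
  inner-edge-not-pendant {e} {u′} {u} {w} {w′} e∋u e∋w u′u uw ww′ u′≢w u≢w′ =
    [ endpoint-degree≢1 (src∋ refl) , endpoint-degree≢1 (tgt∋ refl) ]′
    where
      endpoint-degree≢1 : ∀ {v} → e ∋ v → degree G v ≢ 1
      endpoint-degree≢1 e∋v with endpoint-is-one-of e∋u e∋w (adj⇒≢ uw) e∋v
      ... | inj₁ refl = two-neighbours⇒degree≢1 uw (adj-flip u′u) (u′≢w ∘ sym)
      ... | inj₂ refl = two-neighbours⇒degree≢1 (adj-flip uw) ww′ u≢w′

  NoThreeEdgePath : Set
  NoThreeEdgePath = ∀ {u′ u w w′} → T (adj u′ u) → T (adj u w) → T (adj w w′) → u′ ≢ w → u ≢ w′ → ⊥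

module Forest {n : ℕ} (G : SimpleGraph n) (acyclic : Acyclic G) where
  open SimpleGraph G
  open Edges G

  no-triangle : ∀ {x y z} → T (adj x y) → T (adj y z) → T (adj x z) → ⊥
  no-triangle {x} {y} {z} xy yz xz = acyclic record
    { len    = 0
    ; vtx    = lookup (x ∷ y ∷ z ∷ [])
    ; inj    = λ {i} {j} → lookup-injective distinct i j
    ; steps  = λ { 0F → xy ; 1F → yz }
    ; closes = adj-flip xz
    }
    where
      distinct : Unique (x ∷ y ∷ z ∷ [])
      distinct = (adj⇒≢ xy ∷ adj⇒≢ xz ∷ []) ∷ (adj⇒≢ yz ∷ []) ∷ [] ∷ []

  no-square : ∀ {p q r s} → T (adj p q) → T (adj q r) → T (adj r s) → T (adj s p) → p ≢ r → q ≢ s → ⊥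
  no-square {p} {q} {r} {s} pq qr rs sp p≢r q≢s = acyclic record
    { len    = 1
    ; vtx    = lookup (p ∷ q ∷ r ∷ s ∷ [])
    ; inj    = λ {i} {j} → lookup-injective distinct i j
    ; steps  = λ { 0F → pq ; 1F → qr ; 2F → rs }
    ; closes = sp
    }
    where
      distinct : Unique (p ∷ q ∷ r ∷ s ∷ [])
      distinct = (adj⇒≢ pq ∷ p≢r ∷ adj⇒≢ sp ∘ sym ∷ [])
               ∷ (adj⇒≢ qr ∷ q≢s ∷ []) ∷ (adj⇒≢ rs ∷ []) ∷ [] ∷ []

  triangle-common-endpoint : ∀ {g₁ g₂ g₃ p} → g₁ ≢ g₂ → g₁ ∋ p → g₂ ∋ p →
                             ShareEnd G g₁ g₃ → ShareEnd G g₂ g₃ → g₃ ∋ p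
  triangle-common-endpoint {g₁} {g₂} {g₃} {p} g₁≢g₂ g₁∋p g₂∋p s₁₃ s₂₃
    with share⇒common-endpoint {g₁} {g₃} s₁₃ | share⇒common-endpoint {g₂} {g₃} s₂₃
  ... | q₁ , g₁∋q₁ , g₃∋q₁ | q₂ , g₂∋q₂ , g₃∋q₂ with q₁ ≟ᶠ p | q₂ ≟ᶠ p | q₁ ≟ᶠ q₂
  ... | yes refl | _ | _ = g₃∋q₁
  ... | no _ | yes refl | _ = g₃∋q₂
  ... | no q₁≢p | no _ | yes refl =
    ⊥-elim (g₁≢g₂ (same-endpoints⇒≡ g₁∋p g₁∋q₁ (q₁≢p ∘ sym) g₂∋p g₂∋q₂))
  ... | no q₁≢p | no q₂≢p | no q₁≢q₂ =
    ⊥-elim (no-triangle (endpoints-adjacent g₁∋p g₁∋q₁ (q₁≢p ∘ sym))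
                        (endpoints-adjacent g₃∋q₁ g₃∋q₂ q₁≢q₂)
                        (endpoints-adjacent g₂∋p g₂∋q₂ (q₂≢p ∘ sym)))

  lineGraph-diamond : ∀ {g₁ g₂ g₃ g₄} → AdjL G g₁ g₂ →
                      ShareEnd G g₁ g₃ → ShareEnd G g₂ g₃ → ShareEnd G g₁ g₄ → ShareEnd G g₂ g₄ →
                      ShareEnd G g₃ g₄
  lineGraph-diamond {g₁} {g₂} {g₃} {g₄} g₁~g₂ s₁₃ s₂₃ s₁₄ s₂₄
    with share⇒common-endpoint {g₁} {g₂} (proj₂ g₁~g₂)
  ... | p , g₁∋p , g₂∋p =
    common-endpoint⇒share (triangle-common-endpoint {g₃ = g₃} g₁≢g₂ g₁∋p g₂∋p s₁₃ s₂₃)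
                          (triangle-common-endpoint {g₃ = g₄} g₁≢g₂ g₁∋p g₂∋p s₁₄ s₂₄)
    where
      g₁≢g₂ = adjL⇒≢ {g₁} {g₂} g₁~g₂

  -- Otherwise the endpoints shared by consecutive edges would span a 4-cycle of G.
  lineGraph-square : ∀ {g₁ g₂ g₃ g₄} →
                     ShareEnd G g₁ g₂ → ShareEnd G g₂ g₃ → ShareEnd G g₃ g₄ → ShareEnd G g₄ g₁ →
                     ¬ ShareEnd G g₁ g₃ → ShareEnd G g₂ g₄
  lineGraph-square {g₁} {g₂} {g₃} {g₄} s₁₂ s₂₃ s₃₄ s₄₁ ¬s₁₃ with share? g₂ g₄
  ... | yes s₂₄ = s₂₄
  ... | no ¬s₂₄
    with share⇒common-endpoint {g₁} {g₂} s₁₂ | share⇒common-endpoint {g₂} {g₃} s₂₃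
       | share⇒common-endpoint {g₃} {g₄} s₃₄ | share⇒common-endpoint {g₄} {g₁} s₄₁
  ... | p , g₁∋p , g₂∋p | q , g₂∋q , g₃∋q | r , g₃∋r , g₄∋r | s , g₄∋s , g₁∋s =
    ⊥-elim (no-square (endpoints-adjacent g₂∋p g₂∋q p≢q) (endpoints-adjacent g₃∋q g₃∋r q≢r)
                      (endpoints-adjacent g₄∋r g₄∋s r≢s) (endpoints-adjacent g₁∋s g₁∋p s≢p) p≢r q≢s)
    where
      p≢q : p ≢ q
      p≢q refl = ¬s₁₃ (common-endpoint⇒share g₁∋p g₃∋q)
      q≢r : q ≢ r
      q≢r refl = ¬s₂₄ (common-endpoint⇒share g₂∋q g₄∋r)
      r≢s : r ≢ s
      r≢s refl = ¬s₁₃ (common-endpoint⇒share g₁∋s g₃∋r)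
      s≢p : s ≢ p
      s≢p refl = ¬s₂₄ (common-endpoint⇒share g₂∋p g₄∋s)
      p≢r : p ≢ r
      p≢r refl = ¬s₁₃ (common-endpoint⇒share g₁∋p g₃∋r)
      q≢s : q ≢ s
      q≢s refl = ¬s₂₄ (common-endpoint⇒share g₂∋q g₄∋s)

module Star {n : ℕ} (G : SimpleGraph n) (connected : Connected G) (acyclic : Acyclic G)
            (no-path : Edges.NoThreeEdgePath G) where
  open SimpleGraph G
  open Edges G
  open Forest G acyclic

  Branching : Fin n → Set
  Branching z = ∀ x → ∃ λ y → T (adj z y) × y ≢ x

  walk-stays-near : ∀ {z u v} → Branching z → Walk G u v → u ≡ z ⊎ T (adj z u) → v ≡ z ⊎ T (adj z v)
  walk-stays-near branching stop near = near
  walk-stays-near branching (step u₁u₂ walk) (inj₁ refl) = walk-stays-near branching walk (inj₂ u₁u₂)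
  walk-stays-near {z} branching (step {u₁} {u₂} u₁u₂ walk) (inj₂ zu₁) with u₂ ≟ᶠ z | branching u₁
  ... | yes u₂≡z | _ = walk-stays-near branching walk (inj₁ u₂≡z)
  ... | no u₂≢z | y , zy , y≢u₁ = ⊥-elim (no-path (adj-flip zy) zu₁ u₁u₂ y≢u₁ (u₂≢z ∘ sym))

  branching-on-every-edge : ∀ {z} → Branching z → ∀ e → e ∋ z
  branching-on-every-edge {z} branching e
    with walk-stays-near branching (connected z (src e)) (inj₁ refl)
       | walk-stays-near branching (connected z (tgt e)) (inj₁ refl)
  ... | inj₁ s≡z | _        = src∋ s≡z
  ... | inj₂ _   | inj₁ t≡z = tgt∋ t≡z
  ... | inj₂ zs  | inj₂ zt  = ⊥-elim (no-triangle (isAdj e) (adj-flip zt) (adj-flip zs))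

  lineGraph-complete : ∀ {a b} → AdjL G a b → ∀ x y → x ≢ y → AdjL G x y
  lineGraph-complete {a} {b} a~b x y x≢y with share⇒common-endpoint {a} {b} (proj₂ a~b)
  ... | z , a∋z , b∋z with other-endpoint a∋z | other-endpoint b∋z
  ... | a′ , a∋a′ , a′≢z | b′ , b∋b′ , b′≢z =
    adjL-intro x≢y (common-endpoint⇒share (branching-on-every-edge branching x)
                                          (branching-on-every-edge branching y))
    where
      branching : Branching z
      branching v with a′ ≟ᶠ v
      ... | no a′≢v = a′ , endpoints-adjacent a∋z a∋a′ (a′≢z ∘ sym) , a′≢v
      ... | yes refl = b′ , endpoints-adjacent b∋z b∋b′ (b′≢z ∘ sym) ,
                       λ b′≡a′ → adjL⇒≢ {a} {b} a~b
                                   (same-endpoints⇒≡ a∋z a∋a′ (a′≢z ∘ sym) b∋z (subst (b ∋_) b′≡a′ b∋b′))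

module Decomposition {n : ℕ} (F : SimpleGraph n) {m : ℕ} (D : Fin m → Part F) {R : Edge F → Bool}
                     (valid : ValidDecomposition F D R) where
  open Edges F
  open ValidDecomposition valid

  infix 4 _∈D_
  _∈D_ : Edge F → Fin m → Set
  x ∈D k = _∈ᴾ_ F x (D k)

  _∈D?_ : ∀ x k → Dec (x ∈D k)
  x ∈D? k = _∈ᴾ?_ F x (D k)

  private
    ∈tri : ∀ {x a b c} → _∈ᴾ_ F x (tri a b c) → x ≡ a ⊎ x ≡ b ⊎ x ≡ c
    ∈tri (inj₁ x≈a)        = inj₁ (SameEdge⇒≡ x≈a)
    ∈tri (inj₂ (inj₁ x≈b)) = inj₂ (inj₁ (SameEdge⇒≡ x≈b))
    ∈tri (inj₂ (inj₂ x≈c)) = inj₂ (inj₂ (SameEdge⇒≡ x≈c))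

    ∈edg : ∀ {x a b} → _∈ᴾ_ F x (edg a b) → x ≡ a ⊎ x ≡ b
    ∈edg (inj₁ x≈a) = inj₁ (SameEdge⇒≡ x≈a)
    ∈edg (inj₂ x≈b) = inj₂ (SameEdge⇒≡ x≈b)

  part-members-share : ∀ {P x y} → PartInL F P → _∈ᴾ_ F x P → _∈ᴾ_ F y P → ShareEnd F x y
  part-members-share {tri a b c} {x} {y} (ab , bc , ac) x∈ y∈
    with ∈tri {x} {a} {b} {c} x∈ | ∈tri {y} {a} {b} {c} y∈
  ... | inj₁ refl        | inj₁ refl        = share-refl a
  ... | inj₁ refl        | inj₂ (inj₁ refl) = proj₂ ab
  ... | inj₁ refl        | inj₂ (inj₂ refl) = proj₂ ac
  ... | inj₂ (inj₁ refl) | inj₁ refl        = share-sym {a} {b} (proj₂ ab)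
  ... | inj₂ (inj₁ refl) | inj₂ (inj₁ refl) = share-refl b
  ... | inj₂ (inj₁ refl) | inj₂ (inj₂ refl) = proj₂ bc
  ... | inj₂ (inj₂ refl) | inj₁ refl        = share-sym {a} {c} (proj₂ ac)
  ... | inj₂ (inj₂ refl) | inj₂ (inj₁ refl) = share-sym {b} {c} (proj₂ bc)
  ... | inj₂ (inj₂ refl) | inj₂ (inj₂ refl) = share-refl c
  part-members-share {edg a b} {x} {y} ab x∈ y∈ with ∈edg {x} {a} {b} x∈ | ∈edg {y} {a} {b} y∈
  ... | inj₁ refl | inj₁ refl = share-refl a
  ... | inj₁ refl | inj₂ refl = proj₂ ab
  ... | inj₂ refl | inj₁ refl = share-sym {a} {b} (proj₂ ab)
  ... | inj₂ refl | inj₂ refl = share-refl b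

  part-two-members : ∀ {P} → PartInL F P → ∃₂ λ x y → x ≢ y × _∈ᴾ_ F x P × _∈ᴾ_ F y P
  part-two-members {tri a b _} (ab , _) =
    a , b , adjL⇒≢ {a} {b} ab , inj₁ (refl , refl) , inj₂ (inj₁ (refl , refl))
  part-two-members {edg a b} ab = a , b , adjL⇒≢ {a} {b} ab , inj₁ (refl , refl) , inj₂ (refl , refl)

  members-share : ∀ {x y k} → x ∈D k → y ∈D k → ShareEnd F x y
  members-share {k = k} = part-members-share (parts-in-L k)

  members-adjacent : ∀ {x y k} → x ≢ y → x ∈D k → y ∈D k → AdjL F x y
  members-adjacent x≢y x∈k y∈k = adjL-intro x≢y (members-share x∈k y∈k)

  part-unique : ∀ {x y i j} → x ≢ y → x ∈D i → y ∈D i → x ∈D j → y ∈D j → i ≡ j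
  part-unique {x} {y} {i} {j} x≢y x∈i y∈i = disjoint x y (members-adjacent x≢y x∈i y∈i) i j x∈i y∈i

  meet-unique : ∀ {x y i j} → i ≢ j → x ∈D i → x ∈D j → y ∈D i → y ∈D j → x ≡ y
  meet-unique {x} {y} i≢j x∈i x∈j y∈i y∈j with x ≟ᴱ y
  ... | yes x≡y = x≡y
  ... | no x≢y  = ⊥-elim (i≢j (part-unique x≢y x∈i y∈i x∈j y∈j))

  edge-part-members : ∀ {P} → IsEdgePart F P → PartInL F P →
                      ∃₂ λ a b → a ≢ b × _∈ᴾ_ F a P × _∈ᴾ_ F b P × (∀ x → _∈ᴾ_ F x P → x ≡ a ⊎ x ≡ b)
  edge-part-members {edg a b} _ ab =
    a , b , adjL⇒≢ {a} {b} ab , inj₁ (refl , refl) , inj₂ (refl , refl) , λ x → ∈edg {x}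

  another-member : ∀ k x → ∃ λ y → y ≢ x × y ∈D k
  another-member k x with part-two-members (parts-in-L k)
  ... | y₁ , y₂ , y₁≢y₂ , y₁∈k , y₂∈k with y₁ ≟ᴱ x
  ... | yes refl = y₂ , y₁≢y₂ ∘ sym , y₂∈k
  ... | no y₁≢x  = y₁ , y₁≢x , y₁∈k

  ∉-second-part : ∀ {x y i j} → i ≢ j → x ≢ y → x ∈D i → y ∈D i → x ∈D j → ¬ y ∈D j
  ∉-second-part i≢j x≢y x∈i y∈i x∈j y∈j = i≢j (part-unique x≢y x∈i y∈i x∈j y∈j)

  parts-differ : ∀ {x i j} → x ∈D i → ¬ x ∈D j → i ≢ j
  parts-differ x∈i x∉j refl = x∉j x∈i

  members-differ : ∀ {x y k} → x ∈D k → ¬ y ∈D k → x ≢ y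
  members-differ x∈k y∉k refl = y∉k x∈k

  count≡2⊎3 : ∀ x → partCount F D x ≡ 2 ⊎ partCount F D x ≡ 3
  count≡2⊎3 x with R x | counts x
  ... | true  | count = inj₁ count
  ... | false | count = inj₂ count

  non-pendant⇒count≡3 : (∀ e → T (R e) → Pendant F e) → ∀ x → ¬ Pendant F x → partCount F D x ≡ 3
  non-pendant⇒count≡3 roots-pendant x ¬pendant with R x | counts x | roots-pendant x
  ... | true  | _     | pendant = ⊥-elim (¬pendant (pendant tt))
  ... | false | count | _       = count

  Meet : Fin m → Fin m → Set
  Meet i j = ∃ λ v → v ∈D i × v ∈D j

  module ViaLineGraph {n′ : ℕ} {F′ : SimpleGraph n′} (acyclic′ : Acyclic F′)
                      (iso : IntersectionGraph F D ≅ LineGraph F′) where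
    open _≅_ iso
    open Forest F′ acyclic′ using (lineGraph-diamond; lineGraph-square)

    private
      f : Fin m → Edge F′
      f = Inverse.to bij

      meet⇒adjL : ∀ {i j} → i ≢ j → Meet i j → AdjL F′ (f i) (f j)
      meet⇒adjL {i} {j} i≢j meet = Equivalence.to (adj-iff i j) (i≢j , meet)

      meet⇒share : ∀ {i j} → i ≢ j → Meet i j → ShareEnd F′ (f i) (f j)
      meet⇒share i≢j meet = proj₂ (meet⇒adjL i≢j meet)

      share⇒meet : ∀ {i j} → i ≢ j → ShareEnd F′ (f i) (f j) → Meet i j
      share⇒meet {i} {j} i≢j share =
        proj₂ (Equivalence.from (adj-iff i j)
                                (i≢j ∘ Injection.injective (↔⇒↣ bij) ∘ Edges.SameEdge⇒≡ F′ , share))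

    meet-square : ∀ {i j k l} → i ≢ j → i ≢ k → i ≢ l → j ≢ k → j ≢ l → k ≢ l →
                  Meet i j → Meet j k → Meet k l → Meet l i → ¬ Meet i k → Meet j l
    meet-square {i} {j} {k} {l} i≢j i≢k i≢l j≢k j≢l k≢l ij jk kl li ¬ik =
      share⇒meet j≢l (lineGraph-square {f i} {f j} {f k} {f l}
                        (meet⇒share i≢j ij) (meet⇒share j≢k jk) (meet⇒share k≢l kl)
                        (meet⇒share (i≢l ∘ sym) li) (¬ik ∘ share⇒meet i≢k))

    meet-diamond : ∀ {i j k l} → i ≢ j → i ≢ k → i ≢ l → j ≢ k → j ≢ l → k ≢ l →
                   Meet i j → Meet i k → Meet j k → Meet i l → Meet j l → Meet k l
    meet-diamond {i} {j} {k} {l} i≢j i≢k i≢l j≢k j≢l k≢l ij ik jk il jl =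
      share⇒meet k≢l (lineGraph-diamond {f i} {f j} {f k} {f l}
                        (meet⇒adjL i≢j ij) (meet⇒share i≢k ik) (meet⇒share j≢k jk)
                        (meet⇒share i≢l il) (meet⇒share j≢l jl))
module ForestDecomposition {n : ℕ} {F : SimpleGraph n} (acyclic : Acyclic F)
                         {m : ℕ} {D : Fin m → Part F} {R : Edge F → Bool} (valid : ValidDecomposition F D R)
                         (roots-pendant : ∀ e → T (R e) → Pendant F e)
                         {n′ : ℕ} {F′ : SimpleGraph n′} (acyclic′ : Acyclic F′)
                         (iso : IntersectionGraph F D ≅ LineGraph F′) where
  open Edges F
  open Forest F acyclic
  open ValidDecomposition valid
  open Decomposition F D valid public
  open ViaLineGraph acyclic′ iso

  -- By the diamond i₁ i₂ i₀ Q of I(D), the part Q through e and f meets i₀. A common member shares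
  -- the endpoint w with a and b and the endpoint u with e and f, so it is a; but a ∉ Q.
  edge-in-three-parts-two-at-u : ∀ {a u w i₀ i₁ i₂ b e f} → a ∋ u → a ∋ w → u ≢ w →
                                 i₀ ≢ i₁ → i₀ ≢ i₂ → i₁ ≢ i₂ → a ∈D i₀ → a ∈D i₁ → a ∈D i₂ →
                                 b ≢ a → b ∋ w → b ∈D i₀ → e ≢ a → e ∋ u → e ∈D i₁ →
                                 f ≢ a → f ∋ u → f ∈D i₂ → ⊥
  edge-in-three-parts-two-at-u {a} {u} {w} {i₀} {i₁} {i₂} {b} {e} {f} a∋u a∋w u≢w i₀≢i₁ i₀≢i₂ i₁≢i₂
                               a∈i₀ a∈i₁ a∈i₂ b≢a b∋w b∈i₀ e≢a e∋u e∈i₁ f≢a f∋u f∈i₂ =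
    no-part-through-e-f (covers e f (adjL-intro e≢f (common-endpoint⇒share e∋u f∋u)))
    where
      e∉i₂ : ¬ e ∈D i₂
      e∉i₂ = ∉-second-part i₁≢i₂ (e≢a ∘ sym) a∈i₁ e∈i₁ a∈i₂
      f∉i₁ : ¬ f ∈D i₁
      f∉i₁ = ∉-second-part (i₁≢i₂ ∘ sym) (f≢a ∘ sym) a∈i₂ f∈i₂ a∈i₁
      e≢f : e ≢ f
      e≢f = members-differ f∈i₂ e∉i₂ ∘ sym

      no-part-through-e-f : ¬ ∃ λ Q → e ∈D Q × f ∈D Q
      no-part-through-e-f (Q , e∈Q , f∈Q) =
        no-common-member (meet-diamond i₁≢i₂ (i₀≢i₁ ∘ sym) (parts-differ f∈Q f∉i₁ ∘ sym) (i₀≢i₂ ∘ sym)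
                                       (parts-differ e∈Q e∉i₂ ∘ sym) (parts-differ a∈i₀ a∉Q)
                                       (a , a∈i₁ , a∈i₂) (a , a∈i₁ , a∈i₀) (a , a∈i₂ , a∈i₀)
                                       (e , e∈i₁ , e∈Q) (f , f∈i₂ , f∈Q))
        where
          a∉Q : ¬ a ∈D Q
          a∉Q a∈Q = f∉i₁ (subst (f ∈D_) (part-unique (e≢a ∘ sym) a∈Q e∈Q a∈i₁ e∈i₁) f∈Q)
          no-common-member : ¬ Meet i₀ Q
          no-common-member (g , g∈i₀ , g∈Q) =
            a∉Q (subst (_∈D Q) (same-endpoints⇒≡ g∋u g∋w u≢w a∋u a∋w) g∈Q)
            where
              g∋w = triangle-common-endpoint (b≢a ∘ sym) a∋w b∋w
                      (members-share a∈i₀ g∈i₀) (members-share b∈i₀ g∈i₀)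
              g∋u = triangle-common-endpoint e≢f e∋u f∋u (members-share e∈Q g∈Q) (members-share f∈Q g∈Q)

  edge-in-three-parts-one-each-side : ∀ {a u w P Q K b c} → a ∋ u → a ∋ w → u ≢ w →
                                      P ≢ Q → K ≢ P → K ≢ Q → a ∈D P → a ∈D Q → a ∈D K →
                                      b ≢ a → b ∋ u → b ∈D P → c ≢ a → c ∋ w → c ∈D Q → ⊥
  edge-in-three-parts-one-each-side {a} {K = K} a∋u a∋w u≢w P≢Q K≢P K≢Q a∈P a∈Q a∈K
                                    b≢a b∋u b∈P c≢a c∋w c∈Q with another-member K a
  ... | g , g≢a , g∈K with share⇒common-endpoint {g} {a} (members-share g∈K a∈K)
  ... | v , g∋v , a∋v with endpoint-is-one-of a∋u a∋w u≢w a∋v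
  ... | inj₁ refl = edge-in-three-parts-two-at-u a∋u a∋w u≢w (P≢Q ∘ sym) (K≢Q ∘ sym) (K≢P ∘ sym)
                                                 a∈Q a∈P a∈K c≢a c∋w c∈Q b≢a b∋u b∈P g≢a g∋v g∈K
  ... | inj₂ refl = edge-in-three-parts-two-at-u a∋w a∋u (u≢w ∘ sym) P≢Q (K≢P ∘ sym) (K≢Q ∘ sym)
                                                 a∈P a∈Q a∈K b≢a b∋u b∈P c≢a c∋w c∈Q g≢a g∋v g∈K

  no-three-edge-path : NoThreeEdgePath
  no-three-edge-path {u′} {u} {w} {w′} u′u uw ww′ u′≢w u≢w′
    with edge-between uw | edge-between u′u | edge-between ww′
  ... | mid , mid∋u , mid∋w | left , left∋u′ , left∋u | right , right∋w , right∋w′ =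
    in-parts (covers mid left (adjL-intro (left≢mid ∘ sym) (common-endpoint⇒share mid∋u left∋u)))
             (covers mid right (adjL-intro (right≢mid ∘ sym) (common-endpoint⇒share mid∋w right∋w)))
    where
      u≢w = adj⇒≢ uw
      left≢mid : left ≢ mid
      left≢mid left≡mid =
        [ adj⇒≢ u′u , u′≢w ]′ (endpoint-is-one-of mid∋u mid∋w u≢w (subst (_∋ u′) left≡mid left∋u′))
      right≢mid : right ≢ mid
      right≢mid right≡mid =
        [ u≢w′ ∘ sym , adj⇒≢ ww′ ∘ sym ]′
          (endpoint-is-one-of mid∋u mid∋w u≢w (subst (_∋ w′) right≡mid right∋w′))

      in-parts : (∃ λ P → mid ∈D P × left ∈D P) → (∃ λ Q → mid ∈D Q × right ∈D Q) → ⊥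
      in-parts (P , mid∈P , left∈P) (Q , mid∈Q , right∈Q)
        with Count.count≡3⇒third (mid ∈D?_)
               (non-pendant⇒count≡3 roots-pendant mid (inner-edge-not-pendant mid∋u mid∋w u′u uw ww′ u′≢w u≢w′))
               mid∈P Q
      ... | K , mid∈K , K≢P , K≢Q =
        edge-in-three-parts-one-each-side mid∋u mid∋w u≢w (parts-differ left∈P left∉Q) K≢P K≢Q
                                          mid∈P mid∈Q mid∈K left≢mid left∋u left∈P right≢mid right∋w right∈Q
        where
          left∉Q : ¬ left ∈D Q
          left∉Q left∈Q = right≢mid (same-endpoints⇒≡ right∋u right∋w u≢w mid∋u mid∋w)
            where
              right∋u = triangle-common-endpoint (left≢mid ∘ sym) mid∋u left∋u
                          (members-share mid∈Q right∈Q) (members-share left∈Q right∈Q)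

  module EdgePart (complete : ∀ x y → x ≢ y → AdjL F x y)
                  {i₀ a b} (a≢b : a ≢ b) (a∈i₀ : a ∈D i₀) (b∈i₀ : b ∈D i₀)
                  (only-a-b : ∀ x → x ∈D i₀ → x ≡ a ⊎ x ≡ b) where

    common-part : ∀ {x y} → x ≢ y → ∃ λ k → x ∈D k × y ∈D k
    common-part {x} {y} x≢y = covers x y (complete x y x≢y)

    b∉ : ∀ {k} → k ≢ i₀ → a ∈D k → ¬ b ∈D k
    b∉ k≢i₀ a∈k b∈k = k≢i₀ (part-unique a≢b a∈k b∈k a∈i₀ b∈i₀)

    a∉ : ∀ {k} → k ≢ i₀ → b ∈D k → ¬ a ∈D k
    a∉ k≢i₀ b∈k a∈k = b∉ k≢i₀ a∈k b∈k

    ∉i₀ : ∀ {x} → x ≢ a → x ≢ b → ¬ x ∈D i₀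
    ∉i₀ x≢a x≢b x∈i₀ = [ x≢a , x≢b ]′ (only-a-b _ x∈i₀)

    every-edge-covered : ∀ x → ∃ λ k → x ∈D k
    every-edge-covered x with x ≟ᴱ a
    ... | yes refl = i₀ , a∈i₀
    ... | no x≢a   = let (k , x∈k , _) = common-part x≢a in k , x∈k

    -- i₀, A, Q, B form a 4-cycle of I(D) whose diagonal i₀Q is missing, so AB is present.
    parts-meet : ∀ {A B} → A ≢ i₀ → B ≢ i₀ → a ∈D A → b ∈D B → Meet A B
    parts-meet {A} {B} A≢i₀ B≢i₀ a∈A b∈B with another-member A a | another-member B b
    ... | a₁ , a₁≢a , a₁∈A | b₁ , b₁≢b , b₁∈B with a₁ ≟ᴱ b₁ | A ≟ᶠ B
    ... | yes refl | _        = a₁ , a₁∈A , b₁∈B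
    ... | no _     | yes refl = a , a∈A , a∈A
    ... | no a₁≢b₁ | no A≢B with common-part a₁≢b₁
    ... | Q , a₁∈Q , b₁∈Q with Q ≟ᶠ A | Q ≟ᶠ B
    ... | yes refl | _        = b₁ , b₁∈Q , b₁∈B
    ... | no _     | yes refl = a₁ , a₁∈A , a₁∈Q
    ... | no Q≢A   | no Q≢B   =
      meet-square (A≢i₀ ∘ sym) i₀≢Q (B≢i₀ ∘ sym) (Q≢A ∘ sym) A≢B Q≢B
                  (a , a∈i₀ , a∈A) (a₁ , a₁∈A , a₁∈Q) (b₁ , b₁∈Q , b₁∈B) (b , b∈B , b∈i₀) ¬i₀Q
      where
        ¬i₀Q : ¬ Meet i₀ Q
        ¬i₀Q (x , x∈i₀ , x∈Q) with only-a-b x x∈i₀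
        ... | inj₁ refl = Q≢A (part-unique (a₁≢a ∘ sym) x∈Q a₁∈Q a∈A a₁∈A)
        ... | inj₂ refl = Q≢B (part-unique (b₁≢b ∘ sym) x∈Q b₁∈Q b∈B b₁∈B)
        i₀≢Q : i₀ ≢ Q
        i₀≢Q i₀≡Q = ¬i₀Q (a , a∈i₀ , subst (a ∈D_) i₀≡Q a∈i₀)

    in-other-part : ∀ {c C x} → (∀ k → c ∈D k → k ≡ i₀ ⊎ k ≡ C) → x ≢ c → ¬ x ∈D i₀ → x ∈D C
    in-other-part only-c x≢c x∉i₀ with common-part x≢c
    ... | k , x∈k , c∈k with only-c k c∈k
    ... | inj₁ refl = ⊥-elim (x∉i₀ x∈k)
    ... | inj₂ refl = x∈k

    six-cycle : partCount F D a ≡ 2 → partCount F D b ≡ 2 → IncidenceGraph F D ≅ C6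
    six-cycle a-in-2 b-in-2 with Count.count≡2 (a ∈D?_) a-in-2 a∈i₀ | Count.count≡2 (b ∈D?_) b-in-2 b∈i₀
    ... | A , A≢i₀ , a∈A , only-a | B , B≢i₀ , b∈B , only-b with parts-meet A≢i₀ B≢i₀ a∈A b∈B
    ... | p , p∈A , p∈B =
      ≅-trans (incidence≅biadjacency edges parts every-edge-covered c6-matrix incidence) biadjacency≅C6
      where
        b∉A = b∉ A≢i₀ a∈A
        a∉B = a∉ B≢i₀ b∈B
        p≢a = members-differ p∈B a∉B
        p≢b = members-differ p∈A b∉A
        A≢B = parts-differ a∈A a∉B

        edge-listed : ∀ x → x ∈ a ∷ b ∷ p ∷ []
        edge-listed x with x ≟ᴱ a | x ≟ᴱ b
        ... | yes x≡a | _        = here x≡a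
        ... | no _    | yes x≡b  = there (here x≡b)
        ... | no x≢a  | no x≢b   = there (there (here (meet-unique A≢B (in-other-part only-a x≢a x∉i₀)
                                                        (in-other-part only-b x≢b x∉i₀) p∈A p∈B)))
          where x∉i₀ = ∉i₀ x≢a x≢b

        edges : Fin 3 ↔ Edge F
        edges = enumeration (a ∷ b ∷ p ∷ [])
                  ((a≢b ∷ p≢a ∘ sym ∷ []) ∷ (p≢b ∘ sym ∷ []) ∷ [] ∷ []) edge-listed

        part-listed : ∀ k → k ∈ i₀ ∷ A ∷ B ∷ []
        part-listed k with a ∈D? k | b ∈D? k
        ... | yes a∈k | _       = [ here , (λ k≡A → there (here k≡A)) ]′ (only-a k a∈k)
        ... | no _    | yes b∈k = [ here , (λ k≡B → there (there (here k≡B))) ]′ (only-b k b∈k)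
        ... | no a∉k  | no b∉k with part-two-members (parts-in-L k)
        ... | y , z , y≢z , y∈k , z∈k = ⊥-elim (y≢z (trans (is-p y∈k) (sym (is-p z∈k))))
          where
            is-p : ∀ {x} → x ∈D k → x ≡ p
            is-p {x} x∈k with edge-listed x
            ... | here refl                 = ⊥-elim (a∉k x∈k)
            ... | there (here refl)         = ⊥-elim (b∉k x∈k)
            ... | there (there (here x≡p)) = x≡p

        parts : Fin 3 ↔ Fin m
        parts = enumeration (i₀ ∷ A ∷ B ∷ [])
                  ((A≢i₀ ∘ sym ∷ B≢i₀ ∘ sym ∷ []) ∷ (A≢B ∷ []) ∷ [] ∷ []) part-listed

        incidence : ∀ s t → Reflects (lookup (a ∷ b ∷ p ∷ []) s ∈D lookup (i₀ ∷ A ∷ B ∷ []) t)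
                                     (entry c6-matrix s t)
        incidence 0F 0F = ofʸ a∈i₀
        incidence 0F 1F = ofʸ a∈A
        incidence 0F 2F = ofⁿ a∉B
        incidence 1F 0F = ofʸ b∈i₀
        incidence 1F 1F = ofⁿ b∉A
        incidence 1F 2F = ofʸ b∈B
        incidence 2F 0F = ofⁿ (∉i₀ p≢a p≢b)
        incidence 2F 1F = ofʸ p∈A
        incidence 2F 2F = ofʸ p∈B

    theta : partCount F D a ≡ 2 → partCount F D b ≡ 3 → IncidenceGraph F D ≅ Theta333
    theta a-in-2 b-in-3 with Count.count≡2 (a ∈D?_) a-in-2 a∈i₀ | Count.count≡3 (b ∈D?_) b-in-3 b∈i₀
    ... | A , A≢i₀ , a∈A , only-a | B₁ , B₂ , B₁≢i₀ , B₂≢i₀ , B₁≢B₂ , b∈B₁ , b∈B₂ , only-b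
      with parts-meet A≢i₀ B₁≢i₀ a∈A b∈B₁ | parts-meet A≢i₀ B₂≢i₀ a∈A b∈B₂
    ... | p₁ , p₁∈A , p₁∈B₁ | p₂ , p₂∈A , p₂∈B₂ =
      ≅-trans (incidence≅biadjacency edges parts every-edge-covered θ-matrix incidence) biadjacency≅Θ
      where
        b∉A = b∉ A≢i₀ a∈A
        a∉B₁ = a∉ B₁≢i₀ b∈B₁
        a∉B₂ = a∉ B₂≢i₀ b∈B₂
        p₁≢a = members-differ p₁∈B₁ a∉B₁
        p₁≢b = members-differ p₁∈A b∉A
        p₂≢a = members-differ p₂∈B₂ a∉B₂
        p₂≢b = members-differ p₂∈A b∉A
        p₁∉B₂ = ∉-second-part B₁≢B₂ (p₁≢b ∘ sym) b∈B₁ p₁∈B₁ b∈B₂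
        p₂∉B₁ = ∉-second-part (B₁≢B₂ ∘ sym) (p₂≢b ∘ sym) b∈B₂ p₂∈B₂ b∈B₁
        p₁≢p₂ = members-differ p₁∈B₁ p₂∉B₁
        A≢B₁ = parts-differ a∈A a∉B₁
        A≢B₂ = parts-differ a∈A a∉B₂

        edge-listed : ∀ x → x ∈ a ∷ b ∷ p₁ ∷ p₂ ∷ []
        edge-listed x with x ≟ᴱ a | x ≟ᴱ b
        ... | yes x≡a | _       = here x≡a
        ... | no _    | yes x≡b = there (here x≡b)
        ... | no x≢a  | no x≢b
          with common-part (x≢b) | in-other-part only-a x≢a (∉i₀ x≢a x≢b)
        ... | k , x∈k , b∈k | x∈A with only-b k b∈k
        ... | inj₁ refl        = ⊥-elim (∉i₀ x≢a x≢b x∈k)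
        ... | inj₂ (inj₁ refl) = there (there (here (meet-unique A≢B₁ x∈A x∈k p₁∈A p₁∈B₁)))
        ... | inj₂ (inj₂ refl) = there (there (there (here (meet-unique A≢B₂ x∈A x∈k p₂∈A p₂∈B₂))))

        edges : Fin 4 ↔ Edge F
        edges = enumeration (a ∷ b ∷ p₁ ∷ p₂ ∷ [])
                  ((a≢b ∷ p₁≢a ∘ sym ∷ p₂≢a ∘ sym ∷ []) ∷ (p₁≢b ∘ sym ∷ p₂≢b ∘ sym ∷ []) ∷ (p₁≢p₂ ∷ []) ∷ [] ∷ [])
                  edge-listed

        part-listed : ∀ k → k ∈ i₀ ∷ A ∷ B₁ ∷ B₂ ∷ []
        part-listed k with a ∈D? k | b ∈D? k
        ... | yes a∈k | _ = [ here , (λ k≡A → there (here k≡A)) ]′ (only-a k a∈k)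
        ... | no _    | yes b∈k with only-b k b∈k
        ... | inj₁ k≡i₀         = here k≡i₀
        ... | inj₂ (inj₁ k≡B₁) = there (there (here k≡B₁))
        ... | inj₂ (inj₂ k≡B₂) = there (there (there (here k≡B₂)))
        part-listed k | no a∉k | no b∉k with part-two-members (parts-in-L k)
        ... | y , z , y≢z , y∈k , z∈k = there (here (part-unique y≢z y∈k z∈k (in-A y∈k) (in-A z∈k)))
          where
            in-A : ∀ {x} → x ∈D k → x ∈D A
            in-A {x} x∈k with edge-listed x
            ... | here refl                         = ⊥-elim (a∉k x∈k)
            ... | there (here refl)                 = ⊥-elim (b∉k x∈k)
            ... | there (there (here refl))         = p₁∈A
            ... | there (there (there (here refl))) = p₂∈A

        parts : Fin 4 ↔ Fin m
        parts = enumeration (i₀ ∷ A ∷ B₁ ∷ B₂ ∷ [])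
                  ((A≢i₀ ∘ sym ∷ B₁≢i₀ ∘ sym ∷ B₂≢i₀ ∘ sym ∷ []) ∷ (A≢B₁ ∷ A≢B₂ ∷ []) ∷ (B₁≢B₂ ∷ []) ∷ [] ∷ [])
                  part-listed

        incidence : ∀ s t → Reflects (lookup (a ∷ b ∷ p₁ ∷ p₂ ∷ []) s ∈D lookup (i₀ ∷ A ∷ B₁ ∷ B₂ ∷ []) t)
                                     (entry θ-matrix s t)
        incidence 0F 0F = ofʸ a∈i₀
        incidence 0F 1F = ofʸ a∈A
        incidence 0F 2F = ofⁿ a∉B₁
        incidence 0F 3F = ofⁿ a∉B₂
        incidence 1F 0F = ofʸ b∈i₀
        incidence 1F 1F = ofⁿ b∉A
        incidence 1F 2F = ofʸ b∈B₁
        incidence 1F 3F = ofʸ b∈B₂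
        incidence 2F 0F = ofⁿ (∉i₀ p₁≢a p₁≢b)
        incidence 2F 1F = ofʸ p₁∈A
        incidence 2F 2F = ofʸ p₁∈B₁
        incidence 2F 3F = ofⁿ p₁∉B₂
        incidence 3F 0F = ofⁿ (∉i₀ p₂≢a p₂≢b)
        incidence 3F 1F = ofʸ p₂∈A
        incidence 3F 2F = ofⁿ p₂∉B₁
        incidence 3F 3F = ofʸ p₂∈B₂

    -- By the diamond A₁ B₁ i₀ Q of I(D), the part Q through p₁₁ and p₂₂ would contain a or b.
    not-both-in-three : partCount F D a ≡ 3 → partCount F D b ≡ 3 → ⊥
    not-both-in-three a-in-3 b-in-3
      with Count.count≡3 (a ∈D?_) a-in-3 a∈i₀ | Count.count≡3 (b ∈D?_) b-in-3 b∈i₀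
    ... | A₁ , A₂ , A₁≢i₀ , A₂≢i₀ , A₁≢A₂ , a∈A₁ , a∈A₂ , _ | B₁ , B₂ , B₁≢i₀ , B₂≢i₀ , B₁≢B₂ , b∈B₁ , b∈B₂ , _
      with parts-meet A₁≢i₀ B₁≢i₀ a∈A₁ b∈B₁ | parts-meet A₂≢i₀ B₂≢i₀ a∈A₂ b∈B₂
    ... | p₁₁ , p₁₁∈A₁ , p₁₁∈B₁ | p₂₂ , p₂₂∈A₂ , p₂₂∈B₂ = no-part-through (common-part p₁₁≢p₂₂)
      where
        p₁₁≢a = members-differ p₁₁∈B₁ (a∉ B₁≢i₀ b∈B₁)
        p₁₁≢b = members-differ p₁₁∈A₁ (b∉ A₁≢i₀ a∈A₁)
        p₂₂≢a = members-differ p₂₂∈B₂ (a∉ B₂≢i₀ b∈B₂)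
        p₂₂≢b = members-differ p₂₂∈A₂ (b∉ A₂≢i₀ a∈A₂)
        p₂₂∉A₁ = ∉-second-part (A₁≢A₂ ∘ sym) (p₂₂≢a ∘ sym) a∈A₂ p₂₂∈A₂ a∈A₁
        p₂₂∉B₁ = ∉-second-part (B₁≢B₂ ∘ sym) (p₂₂≢b ∘ sym) b∈B₂ p₂₂∈B₂ b∈B₁
        p₁₁≢p₂₂ = members-differ p₁₁∈A₁ p₂₂∉A₁

        no-part-through : ¬ ∃ λ Q → p₁₁ ∈D Q × p₂₂ ∈D Q
        no-part-through (Q , p₁₁∈Q , p₂₂∈Q) =
          ¬i₀Q (meet-diamond (parts-differ a∈A₁ (a∉ B₁≢i₀ b∈B₁)) A₁≢i₀ A₁≢Q B₁≢i₀ B₁≢Q i₀≢Q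
                             (p₁₁ , p₁₁∈A₁ , p₁₁∈B₁) (a , a∈A₁ , a∈i₀) (b , b∈B₁ , b∈i₀)
                             (p₁₁ , p₁₁∈A₁ , p₁₁∈Q) (p₁₁ , p₁₁∈B₁ , p₁₁∈Q))
          where
            A₁≢Q = parts-differ p₂₂∈Q p₂₂∉A₁ ∘ sym
            B₁≢Q = parts-differ p₂₂∈Q p₂₂∉B₁ ∘ sym
            i₀≢Q = parts-differ p₁₁∈Q (∉i₀ p₁₁≢a p₁₁≢b) ∘ sym
            ¬i₀Q : ¬ Meet i₀ Q
            ¬i₀Q (x , x∈i₀ , x∈Q) with only-a-b x x∈i₀
            ... | inj₁ refl = A₁≢Q (part-unique (p₁₁≢a ∘ sym) a∈A₁ p₁₁∈A₁ x∈Q p₁₁∈Q)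
            ... | inj₂ refl = B₁≢Q (part-unique (p₁₁≢b ∘ sym) b∈B₁ p₁₁∈B₁ x∈Q p₁₁∈Q)

  edge-part-incidence : (∀ x y → x ≢ y → AdjL F x y) →
                        ∀ {i₀ a b} → a ≢ b → a ∈D i₀ → b ∈D i₀ → (∀ x → x ∈D i₀ → x ≡ a ⊎ x ≡ b) →
                        (IncidenceGraph F D ≅ C6) ⊎ (IncidenceGraph F D ≅ Theta333)
  edge-part-incidence complete {a = a} {b} a≢b a∈i₀ b∈i₀ only-a-b = shape (count≡2⊎3 a) (count≡2⊎3 b)
    where
      module ab = EdgePart complete a≢b a∈i₀ b∈i₀ only-a-b
      module ba = EdgePart complete (a≢b ∘ sym) b∈i₀ a∈i₀ (λ x → swap ∘ only-a-b x)

      shape : partCount F D a ≡ 2 ⊎ partCount F D a ≡ 3 → partCount F D b ≡ 2 ⊎ partCount F D b ≡ 3 →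
              (IncidenceGraph F D ≅ C6) ⊎ (IncidenceGraph F D ≅ Theta333)
      shape (inj₁ a-in-2) (inj₁ b-in-2) = inj₁ (ab.six-cycle a-in-2 b-in-2)
      shape (inj₁ a-in-2) (inj₂ b-in-3) = inj₂ (ab.theta a-in-2 b-in-3)
      shape (inj₂ a-in-3) (inj₁ b-in-2) = inj₂ (ba.theta b-in-2 a-in-3)
      shape (inj₂ a-in-3) (inj₂ b-in-3) = ⊥-elim (ab.not-both-in-three a-in-3 b-in-3)

lemma4p13 : ∀ {n n' : ℕ} (F : SimpleGraph n) (F' : SimpleGraph n') →
            IsTree F → IsTree F' →
            (R : Edge F → Bool) → (∀ e → T (R e) → Pendant F e) →
            (m : ℕ) (D : Fin m → Part F) →
            ValidDecomposition F D R →
            (∃ λ i → IsEdgePart F (D i)) →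
            IntersectionGraph F D ≅ LineGraph F' →
            (IncidenceGraph F D ≅ C6) ⊎ (IncidenceGraph F D ≅ Theta333)
lemma4p13 F F′ (_ , connected , acyclic) (_ , _ , acyclic′) R roots-pendant m D valid (i₀ , edge-part) iso =
  let (a , b , a≢b , a∈i₀ , b∈i₀ , only-a-b) = edge-part-members edge-part (parts-in-L i₀)
      complete = Star.lineGraph-complete F connected acyclic no-three-edge-path {a} {b}
                                         (members-adjacent a≢b a∈i₀ b∈i₀)
  in edge-part-incidence complete a≢b a∈i₀ b∈i₀ only-a-b
  where
    open ValidDecomposition valid using (parts-in-L)
    open ForestDecomposition acyclic valid roots-pendant acyclic′ iso
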